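{- Let $N',N''$ and $\mathit{Cut}_0,\dots,\mathit{Cut}_k$, $M_i$, $F_{M_i}$ be as in the context, let $H_0=\mathit{EQ}(X',X'')$, and for $i>0$ let $W_i$ be the set of variables of $F_{M_i}$ that are not in $\mathit{Cut}_i$. Let $i>1$ and let $H_{i-1}$ be a boundary formula (for $\mathit{Cut}_{i-1}$) such that $\exists W_{i-1}[H_0\wedge F_{M_{i-1}}]\equiv H_{i-1}\wedge\exists W_{i-1}[F_{M_{i-1}}]$. Let $H_i$ be a formula over the variables of $\mathit{Cut}_i$ with $\exists W_i[H_{i-1}\wedge F_{M_i}]\equiv H_i\wedge \exists W_i[F_{M_i}]$. Then $\exists W_i[H_0\wedge F_{M_i}]\equiv H_i\wedge\exists W_i[F_{M_i}]$ (and consequently $H_i$ is a boundary formula for $\mathit{Cut}_i$).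
   Context: $N'$ (inputs $X'$, internal variables $Y'$, output $z'$) and $N''$ (inputs $X''$, internal variables $Y''$, output $z''$) are single-output combinational Boolean circuits with disjoint variable sets, $|X'|=|X''|$ with a fixed correspondence; $F_{N'}$, $F_{N''}$ are CNF formulas specifying them (satisfying assignments = assignments consistent with all gates); $\mathit{EQ}(X',X'')$ is true iff corresponding inputs are equal; $G=\mathit{EQ}\wedge F_{N'}\wedge F_{N''}$, $G^{\mathrm{rlx}}=F_{N'}\wedge F_{N''}$. A cut is a set of variables (inputs treated as gate outputs) such that every path from an input to an output passes through a cut variable. $\mathit{Cut}_0=X'\cup X'',\mathit{Cut}_1,\dots,\mathit{Cut}_k=\{z',z''\}$ is a sequence of pairwise disjoint cuts; $M_i$ denotes the subcircuit of gates located between the inputs and $\mathit{Cut}_i$ (the gates on paths from the inputs to the variables of $\mathit{Cut}_i$), and $F_{M_i}$ is the subformula of $G^{\mathrm{rlx}}$ specifying the gates of $M_i$. The cuts are ordered from inputs to outputs: $M_{i-1}\subseteq M_i$ (so $F_{M_{i-1}}\subseteq F_{M_i}$), and every gate of $M_i$ not in $M_{i-1}$ has its inputs among the variables of $\mathit{Cut}_{i-1}$ and outputs of gates of $M_i$ not in $M_{i-1}$. A formula $H$ over the variables of a cut only is a boundary formula for that cut if (a) $G\rightarrow H$, and (b) for every assignment $\vec q$ to the cut variables that can be extended to satisfy $G^{\mathrm{rlx}}$ but not $G$, $H(\vec q)=0$. $\exists W[\cdot]$ is existential quantification and $\equiv$ logical equivalence. -}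

module Defs where

open import Data.Nat using (ℕ; _<_; _≤_; suc)
open import Data.Bool using (Bool)
open import Data.List using (List; []; _∷_; map; length; lookup; _++_)
open import Data.List.Membership.Propositional using (_∈_; _∉_)
open import Data.List.Relation.Unary.All using (All)
open import Data.List.Relation.Binary.Pointwise using (Pointwise)
open import Data.Fin using (Fin; toℕ)
open import Data.Product using (Σ; ∃; _×_; _,_)
open import Data.Sum using (_⊎_)
open import Relation.Nullary using (¬_)
open import Relation.Binary.PropositionalEquality using (_≡_; _≢_)
open import Function.Bundles using (_⇔_)

Var : Set
Var = ℕ

Assignment : Set
Assignment = Var → Bool

Formula : Set₁
Formula = Assignment → Set

record Gate : Set where
  constructor gate
  field
    out : Var
    ins : List Var
    fn  : List Bool → Bool
open Gate public

record Circuit : Set where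
  field
    inputs : List Var
    gates  : List Gate
    output : Var
open Circuit public

-- Combinational (acyclic) circuit: the gate list is topologically ordered,
-- every variable is the output of at most one gate, inputs are not gate
-- outputs, and the output is an input or a gate output.
WellFormed : Circuit → Set
WellFormed C =
  (∀ (j : Fin (length (gates C))) (v : Var) → v ∈ ins (lookup (gates C) j) →
     v ∈ inputs C ⊎ Σ (Fin (length (gates C))) (λ j' → toℕ j' < toℕ j × out (lookup (gates C) j') ≡ v))
  × (∀ (j j' : Fin (length (gates C))) → out (lookup (gates C) j) ≡ out (lookup (gates C) j') → j ≡ j')
  × (∀ (j : Fin (length (gates C))) → out (lookup (gates C) j) ∉ inputs C)
  × (output C ∈ inputs C ⊎ Σ (Fin (length (gates C))) (λ j → out (lookup (gates C) j) ≡ output C))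

CircVar : Circuit → Var → Set
CircVar C v = v ∈ inputs C ⊎ v ≡ output C ⊎ ∃ (λ g → g ∈ gates C × (v ≡ out g ⊎ v ∈ ins g))

-- CNF specification semantics: an assignment satisfies the formula of a
-- set of gates iff it is consistent with every gate.

Consistent : Assignment → Gate → Set
Consistent a g = a (out g) ≡ fn g (map a (ins g))

Spec : Circuit → Formula
Spec C a = All (Consistent a) (gates C)

EQ : List Var → List Var → Formula
EQ X' X'' a = Pointwise (λ x y → a x ≡ a y) X' X''

AllGates : Circuit → Circuit → List Gate
AllGates N' N'' = gates N' ++ gates N''

Grlx : Circuit → Circuit → Formula
Grlx N' N'' a = Spec N' a × Spec N'' a

Gfull : Circuit → Circuit → Formula
Gfull N' N'' a = EQ (inputs N') (inputs N'') a × Spec N' a × Spec N'' a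

data Path (gs : List Gate) : Var → Var → Set where
  here : ∀ {v} → Path gs v v
  step : ∀ {u w} (g : Gate) → g ∈ gs → u ∈ ins g → Path gs (out g) w → Path gs u w

data AvoidPath (gs : List Gate) (C : List Var) : Var → Var → Set where
  here : ∀ {v} → v ∉ C → AvoidPath gs C v v
  step : ∀ {u w} (g : Gate) → u ∉ C → g ∈ gs → u ∈ ins g → AvoidPath gs C (out g) w → AvoidPath gs C u w

IsCut : List Gate → List Var → List Var → List Var → Set
IsCut gs X Z C = ∀ {x z} → x ∈ X → z ∈ Z → ¬ AvoidPath gs C x z

InSub : List Gate → List Var → Gate → Set
InSub gs C g = g ∈ gs × ∃ (λ c → c ∈ C × Path gs (out g) c)

FSub : List Gate → List Var → Formula
FSub gs C a = ∀ g → InSub gs C g → Consistent a g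

VarsSub : List Gate → List Var → Var → Set
VarsSub gs C v = ∃ (λ g → InSub gs C g × (v ≡ out g ⊎ v ∈ ins g))

Inner : List Gate → List Var → Var → Set
Inner gs C v = VarsSub gs C v × v ∉ C

Ex : (Var → Set) → Formula → Formula
Ex W F a = ∃ (λ b → (∀ v → ¬ W v → b v ≡ a v) × F b)

infixr 6 _∧ᶠ_
_∧ᶠ_ : Formula → Formula → Formula
(F ∧ᶠ H) a = F a × H a

infix 4 _≣_
_≣_ : Formula → Formula → Set
F ≣ H = ∀ a → F a ⇔ H a

OverVars : List Var → Formula → Set
OverVars C H = ∀ a b → (∀ v → v ∈ C → a v ≡ b v) → H a → H b

AgreeOn : List Var → Assignment → Assignment → Set
AgreeOn C a b = ∀ v → v ∈ C → a v ≡ b v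

Boundary : Circuit → Circuit → List Var → Formula → Set
Boundary N' N'' C H =
  OverVars C H
  × (∀ a → Gfull N' N'' a → H a)
  × (∀ a → ∃ (λ b → AgreeOn C a b × Grlx N' N'' b)
         → ¬ ∃ (λ b → AgreeOn C a b × Gfull N' N'' b)
         → ¬ H a)

Ordered : List Gate → List Var → List Var → Set
Ordered gs C C' =
  (∀ g → InSub gs C g → InSub gs C' g)
  × (∀ g → InSub gs C' g → ¬ InSub gs C g → ∀ v → v ∈ ins g →
       v ∈ C ⊎ ∃ (λ g' → InSub gs C' g' × ¬ InSub gs C g' × out g' ≡ v))
  × (∀ v → v ∈ C' → ¬ VarsSub gs C v)

CutSeq : Circuit → Circuit → ℕ → (ℕ → List Var) → Set
CutSeq N' N'' k Cut =
  (∀ v → (v ∈ Cut 0) ⇔ (v ∈ inputs N' ⊎ v ∈ inputs N''))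
  × (∀ v → (v ∈ Cut k) ⇔ (v ≡ output N' ⊎ v ≡ output N''))
  × (∀ j → j ≤ k → IsCut (AllGates N' N'') (inputs N' ++ inputs N'') (output N' ∷ output N'' ∷ []) (Cut j))
  × (∀ j j' → j ≤ k → j' ≤ k → j ≢ j' → ∀ v → v ∈ Cut j → v ∉ Cut j')
  × (∀ j → suc j ≤ k → Ordered (AllGates N' N'') (Cut j) (Cut (suc j)))

-- Write Splits W E F H for ∃W[E ∧ F] ≡ H ∧ ∃W[F].  Going from
-- Cut_{i-1} to Cut_i, the new gates of M_i read only Cut_{i-1} and their own
-- outputs, so the variables W_{i-1} hidden at the previous step can be changed
-- freely without breaking F_{M_i}: this lets Splits W_{i-1} H₀ F_{M_{i-1}} H_{i-1}
-- and Splits W_i H_{i-1} F_{M_i} H_i compose to Splits W_i H₀ F_{M_i} H_i.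
-- For the boundary property, an assignment satisfying H₀ ∧ F_{M_i} is completed
-- to one satisfying G by evaluating all gates of N' and N'' in topological
-- order; this changes neither the inputs nor Cut_i, since every gate driving
-- them already lies in M_i.
module Submission where

open import Defs
open import Data.Nat using (ℕ; _<_; _≤_; _∸_; suc; s≤s)
open import Data.Nat.Properties using (_≟_; ≤-refl; <⇒≤; <-irrefl; <-≤-trans)
open import Data.Bool using (Bool)
import Data.Bool.Properties as Bool
open import Data.Fin using (Fin; toℕ)
open import Data.List using (List; []; _∷_; length; map; lookup; tabulate; _++_)
open import Data.List.Properties using (map-cong-local; tabulate-lookup)
open import Data.List.Membership.Propositional using (_∈_; _∉_)
open import Data.List.Relation.Unary.Any using (here; there; index)
open import Data.List.Relation.Unary.Any.Properties using (lookup-index)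
open import Data.List.Relation.Unary.All as All using (All; []; _∷_)
import Data.List.Relation.Unary.All.Properties as Allₚ
open import Data.List.Relation.Unary.AllPairs using (AllPairs; []; _∷_)
import Data.List.Relation.Unary.AllPairs.Properties as AllPairsₚ
open import Data.List.Relation.Binary.Pointwise using ([]; _∷_)
open import Data.Product using (∃; _×_; _,_; proj₁; proj₂)
open import Data.Sum using (inj₁; inj₂)
open import Data.Empty using (⊥; ⊥-elim)
open import Function.Bundles using (mk⇔; Equivalence)
open import Relation.Nullary using (¬_; yes; no)
open import Relation.Nullary.Decidable using (decidable-stable)
open import Relation.Binary.PropositionalEquality
  using (_≡_; _≢_; refl; sym; trans; cong; subst; module ≡-Reasoning)

Splits : (Var → Set) → Formula → Formula → Formula → Set
Splits W E F H = Ex W (E ∧ᶠ F) ≣ (H ∧ᶠ Ex W F)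

Splits-step : ∀ {W V : Var → Set} {E H H' F F' : Formula}
  → (∀ v → W v → V v)
  → (∀ a → F' a → F a)
  → (∀ b c → (∀ v → ¬ W v → c v ≡ b v) → F' b → F c → F' c)
  → Splits W E F H → Splits V H F' H' → Splits V E F' H'
Splits-step {V = V} {E} {H} {H'} {F' = F'} W⊆V F'⇒F F'-extend split split' a = mk⇔ to from
  where
  to : Ex V (E ∧ᶠ F') a → (H' ∧ᶠ Ex V F') a
  to (b , b≈a , Eb , F'b) = Equivalence.to (split' a) (b , b≈a , Hb , F'b)
    where
    Hb : H b
    Hb = proj₁ (Equivalence.to (split b) (b , (λ _ _ → refl) , Eb , F'⇒F b F'b))
  from : (H' ∧ᶠ Ex V F') a → Ex V (E ∧ᶠ F') a
  from H'a-ex with Equivalence.from (split' a) H'a-ex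
  ... | b , b≈a , Hb , F'b with Equivalence.from (split b) (Hb , b , (λ _ _ → refl) , F'⇒F b F'b)
  ... | c , c≈b , Ec , Fc =
    c , (λ v ¬Vv → trans (c≈b v (λ Wv → ¬Vv (W⊆V v Wv))) (b≈a v ¬Vv)) , Ec , F'-extend b c c≈b F'b Fc

set : Assignment → Var → Bool → Assignment
set a x b v with v ≟ x
... | yes _ = b
... | no _ = a v

set-≡ : ∀ a x b → set a x b x ≡ b
set-≡ a x b with x ≟ x
... | yes _ = refl
... | no x≢x = ⊥-elim (x≢x refl)

set-≢ : ∀ a x b {v} → v ≢ x → set a x b v ≡ a v
set-≢ a x b {v} v≢x with v ≟ x
... | yes v≡x = ⊥-elim (v≢x v≡x)
... | no _ = refl

set-agrees : ∀ {P : Var → Set} {a c : Assignment} {x : Var} {b : Bool} → (P x → b ≡ c x)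
  → (∀ {v} → P v → a v ≡ c v) → ∀ {v} → P v → set a x b v ≡ c v
set-agrees {x = x} b≡cx a≈c {v} Pv with v ≟ x
... | yes refl = b≡cx Pv
... | no _ = a≈c Pv

fire : Gate → Assignment → Assignment
fire g a = set a (out g) (fn g (map a (ins g)))

evaluate : List Gate → Assignment → Assignment
evaluate [] a = a
evaluate (g ∷ gs) a = evaluate gs (fire g a)

evaluate-undriven : ∀ {gs a v} → All (λ g → out g ≢ v) gs → evaluate gs a v ≡ a v
evaluate-undriven [] = refl
evaluate-undriven {g ∷ _} {a} (g↛v ∷ gs↛v) =
  trans (evaluate-undriven gs↛v) (set-≢ a (out g) _ (λ e → g↛v (sym e)))

-- g precedes g' in the evaluation order.
NoFeedback : Gate → Gate → Set
NoFeedback g g' = out g' ≢ out g × out g' ∉ ins g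

Topological : List Gate → Set
Topological gs = All (λ g → out g ∉ ins g) gs × AllPairs NoFeedback gs

Topological-++ : ∀ {xs ys} → Topological xs → Topological ys
  → All (λ g → All (NoFeedback g) ys) xs → Topological (xs ++ ys)
Topological-++ (selfs , pairs) (selfs' , pairs') cross =
  Allₚ.++⁺ selfs selfs' , AllPairsₚ.++⁺ pairs pairs' cross

evaluate-consistent : ∀ {gs} a → Topological gs → All (Consistent (evaluate gs a)) gs
evaluate-consistent {[]} a _ = []
evaluate-consistent {g ∷ gs} a (self ∷ selfs , later ∷ pairs) =
  g-consistent ∷ evaluate-consistent (fire g a) (selfs , pairs)
  where
  open ≡-Reasoning
  result : Assignment
  result = evaluate gs (fire g a)

  input-kept : ∀ {u} → u ∈ ins g → a u ≡ result u
  input-kept {u} u∈ = sym (begin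
    result u      ≡⟨ evaluate-undriven (All.map (λ nf e → proj₂ nf (subst (_∈ ins g) (sym e) u∈)) later) ⟩
    fire g a u    ≡⟨ set-≢ a (out g) _ (λ e → self (subst (_∈ ins g) e u∈)) ⟩
    a u           ∎)

  g-consistent : Consistent result g
  g-consistent = begin
    result (out g)               ≡⟨ evaluate-undriven (All.map proj₁ later) ⟩
    fire g a (out g)             ≡⟨ set-≡ a (out g) _ ⟩
    fn g (map a (ins g))         ≡⟨ cong (fn g) (map-cong-local (All.tabulate input-kept)) ⟩
    fn g (map result (ins g))    ∎

evaluate-agrees : ∀ {P : Var → Set} {c : Assignment} gs
  → (∀ {g} → g ∈ gs → P (out g) → Consistent c g × All P (ins g))
  → ∀ {a} → (∀ {v} → P v → a v ≡ c v) → ∀ {v} → P v → evaluate gs a v ≡ c v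
evaluate-agrees [] _ a≈c = a≈c
evaluate-agrees {P} {c} (g ∷ gs) closed {a} a≈c =
  evaluate-agrees gs (λ g'∈ → closed (there g'∈)) fired≈c
  where
  g-output : P (out g) → fn g (map a (ins g)) ≡ c (out g)
  g-output P-out = trans (cong (fn g) (map-cong-local (All.map a≈c (proj₂ (closed (here refl) P-out)))))
                         (sym (proj₁ (closed (here refl) P-out)))

  fired≈c : ∀ {v} → P v → fire g a v ≡ c v
  fired≈c = set-agrees {P = P} g-output a≈c

InSub-input : ∀ {gs C g g'} → g' ∈ gs → out g' ∈ ins g → InSub gs C g → InSub gs C g'
InSub-input g'∈ out∈ins (g∈ , c , c∈ , path) = g'∈ , c , c∈ , step _ g∈ out∈ins path

VarsSub-out⇒InSub : ∀ {gs C g} → g ∈ gs → VarsSub gs C (out g) → InSub gs C g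
VarsSub-out⇒InSub g∈ (g' , (g'∈ , c , c∈ , path) , inj₁ out≡out) =
  g∈ , c , c∈ , subst (λ u → Path _ u c) (sym out≡out) path
VarsSub-out⇒InSub g∈ (g' , below , inj₂ out∈ins) = InSub-input g∈ out∈ins below

-- Holds vacuously for circuit inputs.
DrivenBelow : List Gate → List Var → Var → Set
DrivenBelow gs C v = ∀ {g} → g ∈ gs → out g ≡ v → InSub gs C g

cut-DrivenBelow : ∀ {gs C v} → v ∈ C → DrivenBelow gs C v
cut-DrivenBelow v∈ g∈ refl = g∈ , _ , v∈ , here

FSub-completion : ∀ {gs C c} → Topological gs → FSub gs C c
  → ∃ λ e → All (Consistent e) gs × (∀ {v} → DrivenBelow gs C v → e v ≡ c v)
FSub-completion {gs} {C} {c} topological c-consistent =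
  evaluate gs c , evaluate-consistent c topological , evaluate-agrees gs closed (λ _ → refl)
  where
  closed : ∀ {g} → g ∈ gs → DrivenBelow gs C (out g)
    → Consistent c g × All (DrivenBelow gs C) (ins g)
  closed {g} g∈ driven = c-consistent g below , All.tabulate input-driven
    where
    below : InSub gs C g
    below = driven g∈ refl
    input-driven : ∀ {u} → u ∈ ins g → DrivenBelow gs C u
    input-driven u∈ g'∈ refl = InSub-input g'∈ u∈ below

module _ {gs C D} (ordered : Ordered gs C D) where

  Ordered⇒Inner-mono : ∀ v → Inner gs C v → Inner gs D v
  Ordered⇒Inner-mono v ((g , below , v-at-g) , _) =
    (g , proj₁ ordered g below , v-at-g) , λ v∈D → proj₂ (proj₂ ordered) v v∈D (g , below , v-at-g)

  Ordered⇒FSub-antitone : ∀ a → FSub gs D a → FSub gs C a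
  Ordered⇒FSub-antitone a a-consistent g below = a-consistent g (proj₁ ordered g below)

  -- The gates of M_D outside M_C read no hidden variable of M_C.
  Ordered⇒FSub-extend : ∀ b c → (∀ v → ¬ Inner gs C v → c v ≡ b v)
    → FSub gs D b → FSub gs C c → FSub gs D c
  Ordered⇒FSub-extend b c c≈b b-consistent c-consistent g below-D =
    -- InSub is undecidable, but consistency of a gate is a Boolean equation.
    decidable-stable (c (out g) Bool.≟ fn g (map c (ins g)))
      (λ ¬consistent → ¬consistent (new-gate (λ below-C → ¬consistent (c-consistent g below-C))))
    where
    open ≡-Reasoning
    g∈ : g ∈ gs
    g∈ = proj₁ below-D

    out-visible : ∀ {g'} → g' ∈ gs → ¬ InSub gs C g' → ¬ Inner gs C (out g')
    out-visible g'∈ not-below (vars , _) = not-below (VarsSub-out⇒InSub g'∈ vars)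

    new-gate : ¬ InSub gs C g → Consistent c g
    new-gate not-below = begin
      c (out g)              ≡⟨ c≈b (out g) (out-visible g∈ not-below) ⟩
      b (out g)              ≡⟨ b-consistent g below-D ⟩
      fn g (map b (ins g))   ≡⟨ cong (fn g) (map-cong-local (All.tabulate (λ u∈ → sym (c≈b _ (input-visible u∈))))) ⟩
      fn g (map c (ins g))   ∎
      where
      input-visible : ∀ {u} → u ∈ ins g → ¬ Inner gs C u
      input-visible {u} u∈ with proj₁ (proj₂ ordered) g below-D not-below u u∈
      ... | inj₁ u∈C = λ inner → proj₂ inner u∈C
      ... | inj₂ (g' , below-D' , not-below' , refl) = out-visible (proj₁ below-D') not-below'

WellFormed⇒Topological : ∀ {N} → WellFormed N → Topological (gates N)
WellFormed⇒Topological {N} (reads-earlier , out-injective , out∉inputs , _) =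
  subst Topological (tabulate-lookup (gates N))
    ( Allₚ.tabulate⁺ (λ j → no-feedback j j ≤-refl)
    , AllPairsₚ.tabulate⁺-< (λ {j} {j'} j<j' →
        (λ e → <-irrefl (cong toℕ (out-injective j j' (sym e))) j<j') , no-feedback j j' (<⇒≤ j<j')))
  where
  gate-at : Fin (length (gates N)) → Gate
  gate-at = lookup (gates N)
  no-feedback : ∀ j j' → toℕ j ≤ toℕ j' → out (gate-at j') ∉ ins (gate-at j)
  no-feedback j j' j≤j' out∈ins with reads-earlier j _ out∈ins
  ... | inj₁ out∈inputs = out∉inputs j' out∈inputs
  ... | inj₂ (j'' , j''<j , out≡out) with out-injective j'' j' out≡out
  ... | refl = <-irrefl refl (<-≤-trans j''<j j≤j')

WellFormed⇒inputs-undriven : ∀ {N x} → WellFormed N → x ∈ inputs N → All (λ g → out g ≢ x) (gates N)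
WellFormed⇒inputs-undriven {N} (_ , _ , out∉inputs , _) x∈ = All.tabulate undriven
  where
  undriven : ∀ {g} → g ∈ gates N → out g ≢ _
  undriven g∈ refl = out∉inputs (index g∈) (subst (_∈ inputs N) (cong out (lookup-index g∈)) x∈)

Disjoint : Circuit → Circuit → Set
Disjoint N M = ∀ v → CircVar N v → CircVar M v → ⊥

Disjoint⇒undriven : ∀ {N M x} → Disjoint N M → CircVar N x → All (λ g → out g ≢ x) (gates M)
Disjoint⇒undriven disjoint x-in-N = All.tabulate λ g∈ out≡x →
  disjoint _ x-in-N (inj₂ (inj₂ (_ , g∈ , inj₁ (sym out≡x))))

Disjoint⇒NoFeedback : ∀ {N M} → Disjoint N M → All (λ g → All (NoFeedback g) (gates M)) (gates N)
Disjoint⇒NoFeedback {N} {M} disjoint = All.tabulate λ {g} g∈ → All.tabulate λ {g'} g'∈ →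
  let out'-in-M = inj₂ (inj₂ (g' , g'∈ , inj₁ refl)) in
    (λ out≡out → disjoint _ (inj₂ (inj₂ (g , g∈ , inj₁ out≡out))) out'-in-M)
  , (λ out∈ins → disjoint _ (inj₂ (inj₂ (g , g∈ , inj₂ out∈ins))) out'-in-M)

EQ-cong : ∀ {c e : Assignment} {xs ys} → All (λ x → e x ≡ c x) xs → All (λ y → e y ≡ c y) ys
  → EQ xs ys c → EQ xs ys e
EQ-cong _ _ [] = []
EQ-cong (ex≡cx ∷ exs) (ey≡cy ∷ eys) (cx≡cy ∷ eqs) = trans ex≡cx (trans cx≡cy (sym ey≡cy)) ∷ EQ-cong exs eys eqs

module _ {N' N''} (wf' : WellFormed N') (wf'' : WellFormed N'') (disjoint : Disjoint N' N'') where

  private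
    gs : List Gate
    gs = AllGates N' N''

  AllGates-topological : Topological gs
  AllGates-topological =
    Topological-++ (WellFormed⇒Topological wf') (WellFormed⇒Topological wf'') (Disjoint⇒NoFeedback disjoint)

  inputs'-undriven : ∀ {x} → x ∈ inputs N' → All (λ g → out g ≢ x) gs
  inputs'-undriven x∈ =
    Allₚ.++⁺ (WellFormed⇒inputs-undriven wf' x∈) (Disjoint⇒undriven disjoint (inj₁ x∈))

  inputs''-undriven : ∀ {x} → x ∈ inputs N'' → All (λ g → out g ≢ x) gs
  inputs''-undriven x∈ =
    Allₚ.++⁺ (Disjoint⇒undriven (λ v p q → disjoint v q p) (inj₁ x∈)) (WellFormed⇒inputs-undriven wf'' x∈)

  Grlx⇒FSub : ∀ {C a} → Grlx N' N'' a → FSub gs C a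
  Grlx⇒FSub (spec' , spec'') g below = All.lookup (Allₚ.++⁺ spec' spec'') (proj₁ below)

  Splits⇒Boundary : ∀ {C H} → OverVars C H
    → Splits (Inner gs C) (EQ (inputs N') (inputs N'')) (FSub gs C) H → Boundary N' N'' C H
  Splits⇒Boundary {C} {H} over-C split = over-C , full⇒H , relaxed-only⇒¬H
    where
    full⇒H : ∀ a → Gfull N' N'' a → H a
    full⇒H a (eq , rlx) = proj₁ (Equivalence.to (split a) (a , (λ _ _ → refl) , eq , Grlx⇒FSub rlx))

    undriven⇒DrivenBelow : ∀ {x} → All (λ g → out g ≢ x) gs → DrivenBelow gs C x
    undriven⇒DrivenBelow undriven g∈ out≡x = ⊥-elim (All.lookup undriven g∈ out≡x)

    relaxed-only⇒¬H : ∀ a → ∃ (λ b → AgreeOn C a b × Grlx N' N'' b)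
      → ¬ ∃ (λ b → AgreeOn C a b × Gfull N' N'' b) → ¬ H a
    relaxed-only⇒¬H a (b , a≈b , rlx) no-full Ha
      with Equivalence.from (split b) (over-C a b a≈b Ha , b , (λ _ _ → refl) , Grlx⇒FSub rlx)
    ... | c , c≈b , eq-c , c-sub with FSub-completion AllGates-topological c-sub
    ... | e , e-consistent , e≈c = no-full (e , a≈e , eq-e , Allₚ.++⁻ (gates N') e-consistent)
      where
      a≈e : AgreeOn C a e
      a≈e v v∈C = trans (a≈b v v∈C) (sym (trans (e≈c (cut-DrivenBelow v∈C)) (c≈b v (λ inner → proj₂ inner v∈C))))
      eq-e : EQ (inputs N') (inputs N'') e
      eq-e = EQ-cong (All.tabulate (λ x∈ → e≈c (undriven⇒DrivenBelow (inputs'-undriven x∈))))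
                     (All.tabulate (λ x∈ → e≈c (undriven⇒DrivenBelow (inputs''-undriven x∈))))
                     eq-c

proposition5 : (N' N'' : Circuit) → WellFormed N' → WellFormed N''
    → (∀ v → CircVar N' v → CircVar N'' v → ⊥)
    → length (inputs N') ≡ length (inputs N'')
    → (k : ℕ) (Cut : ℕ → List Var) → CutSeq N' N'' k Cut
    → (i : ℕ) → 1 < i → i ≤ k
    → (Hprev Hi : Formula)
    → Boundary N' N'' (Cut (i ∸ 1)) Hprev
    → Ex (Inner (AllGates N' N'') (Cut (i ∸ 1))) (EQ (inputs N') (inputs N'') ∧ᶠ FSub (AllGates N' N'') (Cut (i ∸ 1)))
        ≣ (Hprev ∧ᶠ Ex (Inner (AllGates N' N'') (Cut (i ∸ 1))) (FSub (AllGates N' N'') (Cut (i ∸ 1))))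
    → OverVars (Cut i) Hi
    → Ex (Inner (AllGates N' N'') (Cut i)) (Hprev ∧ᶠ FSub (AllGates N' N'') (Cut i))
        ≣ (Hi ∧ᶠ Ex (Inner (AllGates N' N'') (Cut i)) (FSub (AllGates N' N'') (Cut i)))
    → (Ex (Inner (AllGates N' N'') (Cut i)) (EQ (inputs N') (inputs N'') ∧ᶠ FSub (AllGates N' N'') (Cut i))
         ≣ (Hi ∧ᶠ Ex (Inner (AllGates N' N'') (Cut i)) (FSub (AllGates N' N'') (Cut i))))
      × Boundary N' N'' (Cut i) Hi
proposition5 N' N'' wf' wf'' disjoint _ _ Cut cuts (suc (suc j)) (s≤s (s≤s _)) i≤k _ Hi _
             split-prev over-i split-i =
  split , Splits⇒Boundary wf' wf'' disjoint over-i split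
  where
  ordered : Ordered (AllGates N' N'') (Cut (suc j)) (Cut (suc (suc j)))
  ordered = proj₂ (proj₂ (proj₂ (proj₂ cuts))) (suc j) i≤k

  split : Splits (Inner (AllGates N' N'') (Cut (suc (suc j)))) (EQ (inputs N') (inputs N''))
                 (FSub (AllGates N' N'') (Cut (suc (suc j)))) Hi
  split = Splits-step (Ordered⇒Inner-mono ordered) (Ordered⇒FSub-antitone ordered)
                      (Ordered⇒FSub-extend ordered) split-prev split-i
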